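{- (1) For every set of labels $\mathbb{U}$, every cycle property $Y\subseteq\mathbb{U}^*$ and every arena $\mathcal{A}=(V_0,V_1,E,\mathbb{U},\lambda)$ with $V_0=\emptyset$ or $V_1=\emptyset$, the game $(\mathcal{A},O_{\mathrm{FC}(Y)}(\mathcal{A}))$ is pointwise memoryless determined. (2) There exist a cycle property $Y$ and an arena $\mathcal{A}$ with $V_0=\emptyset$ or $V_1=\emptyset$ such that the game $(\mathcal{A},O_{\mathrm{FC}(Y)}(\mathcal{A}))$ is not uniform memoryless determined. (3) Let $Y\subseteq\mathbb{U}^*$ be a cycle property closed under cyclic permutations, let $\mathcal{A}$ be an arena with labels in $\mathbb{U}$, and let $i\in\{0,1\}$. If the game $(\mathcal{A},O_{\mathrm{FC}(Y)}(\mathcal{A}))$ is pointwise memoryless for Player $i$, then it is uniform memoryless for Player $i$.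
   Context: An arena is a tuple $\mathcal{A}=(V_0,V_1,E,\mathbb{U},\lambda)$ where $V_0,V_1$ are disjoint finite sets (the vertices of Player 0 and Player 1) with $V:=V_0\cup V_1$ non-empty, $E\subseteq V\times V$ is a set of edges such that every vertex has at least one outgoing edge, $\mathbb{U}$ is a set of labels, and $\lambda:E\to\mathbb{U}$. For a sequence of edges $u=e_1e_2\cdots$, write $\lambda(u)=\lambda(e_1)\lambda(e_2)\cdots$. A play is an infinite sequence $\pi=\pi_0\pi_1\cdots$ of vertices with $(\pi_j,\pi_{j+1})\in E$ for all $j$; $\mathrm{plays}(\mathcal{A})$ is the set of plays. A strategy for Player $i$ is a function $S:V^*V_i\to V$ with $(v,S(uv))\in E$ for all $u\in V^*$, $v\in V_i$; it is memoryless if $S(uv)=S(u'v)$ for all $u,u'\in V^*$, $v\in V_i$. A play is consistent with a strategy $S$ of Player $i$ if $\pi_{j+1}=S(\pi_0\cdots\pi_j)$ whenever $\pi_j\in V_i$. A game is a pair $(\mathcal{A},O)$ with $O\subseteq\mathrm{plays}(\mathcal{A})$; a play is won by Player 0 if it is in $O$ and by Player 1 otherwise. A strategy for Player $i$ is winning from $v$ if every play starting at $v$ consistent with it is won by Player $i$. The winning region of Player $i$ is the set of vertices from which Player $i$ has a winning strategy. The game is determined if the two winning regions partition $V$. It is pointwise memoryless for Player $i$ if from every vertex of Player $i$'s winning region Player $i$ has a memoryless winning strategy; it is uniform memoryless for Player $i$ if there is one memoryless strategy for Player $i$ that is winning from every vertex of Player $i$'s winning region. It is pointwise (resp. uniform)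 memoryless determined if it is determined and pointwise (resp. uniform) memoryless for both players. A cycle is a sequence of edges $(v_1,v_2)(v_2,v_3)\cdots(v_{k-1},v_k)(v_k,v_1)$. The cycles-decomposition $\mathrm{cycles}(\pi)$ of a play $\pi$ is the sequence of cycles output by the following procedure: start with an empty stack; at step $j=0,1,2,\dots$ push the edge $(\pi_j,\pi_{j+1})$, and if for some $k$ the top $k$ edges of the stack form a cycle, pop this cycle and output it. The first cycle of $\pi$ is the first cycle in $\mathrm{cycles}(\pi)$. A cycle property is a set $Y\subseteq\mathbb{U}^*$. $Y$ is closed under cyclic permutations if $ab\in Y$ implies $ba\in Y$ for all $a\in\mathbb{U}$, $b\in\mathbb{U}^*$. $O_{\mathrm{FC}(Y)}(\mathcal{A})$ is the set of plays $\pi$ such that $\lambda(u)\in Y$, where $u$ is the first cycle of $\pi$. -}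

module Defs where

open import Level using (0ℓ)
open import Data.Nat using (ℕ; zero; suc; _<_; _≤_)
open import Data.Fin using (Fin)
open import Data.List using (List; []; _∷_; map; drop; upTo)
open import Data.Product using (Σ; ∃; _×_; _,_; uncurry)
open import Data.Sum using (_⊎_)
open import Data.Empty using (⊥)
open import Relation.Nullary using (¬_)
open import Relation.Binary.PropositionalEquality using (_≡_)

Player : Set
Player = Fin 2

-- The (finite, non-empty) vertex set is Fin n;
-- owner v ≡ 0 means v ∈ V₀, owner v ≡ 1 means v ∈ V₁ (so V₀, V₁ are disjoint
-- and cover V).  E is the edge relation; lab is the labelling λ (only its
-- values on edges matter).
record Arena (U : Set) : Set₁ where
  field
    n        : ℕ
    nonempty : 0 < n
    owner    : Fin n → Player
    E        : Fin n → Fin n → Set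
    total    : ∀ v → Σ (Fin n) (E v)
    lab      : Fin n → Fin n → U

module _ {U : Set} (A : Arena U) where
  open Arena A

  V : Set
  V = Fin n

  Edge : Set
  Edge = V × V

  IsPlay : (ℕ → V) → Set
  IsPlay π = ∀ j → E (π j) (π (suc j))

  labels : List Edge → List U
  labels = map (uncurry lab)

  PathFT : V → List Edge → V → Set
  PathFT a [] b = a ≡ b
  PathFT a ((x , y) ∷ es) b = (a ≡ x) × PathFT y es b

  IsCycle : List Edge → Set
  IsCycle [] = ⊥
  IsCycle ((x , y) ∷ es) = PathFT y es x

  -- edges (π0,π1) ... (πj,πj+1): the stack content after pushing at steps
  -- 0..j when nothing has been popped yet (bottom first)
  edgesUpTo : (ℕ → V) → ℕ → List Edge
  edgesUpTo π j = map (λ t → (π t , π (suc t))) (upTo (suc j))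

  -- u is the first cycle output by the cycle-decomposition procedure:
  -- at step j the top edges of the stack form the cycle u, and at no
  -- earlier step did any top segment of the stack form a cycle.
  FirstCycle : (ℕ → V) → List Edge → Set
  FirstCycle π u =
    ∃ λ j → (∃ λ i → u ≡ drop i (edgesUpTo π j) × IsCycle u)
          × (∀ j' → j' < j → ∀ i → ¬ IsCycle (drop i (edgesUpTo π j')))

  OFC : (Y : List U → Set) → (ℕ → V) → Set
  OFC Y π = ∃ λ u → FirstCycle π u × Y (labels u)

  -- strategies S : V* V_i → V (given on all of V* V, values outside V* V_i irrelevant)
  record Strategy (i : Player) : Set where
    field
      move  : List V → V → V
      legal : ∀ u v → owner v ≡ i → E v (move u v)

  Memoryless : {i : Player} → Strategy i → Set
  Memoryless {i} S = ∀ u u' v → owner v ≡ i → Strategy.move S u v ≡ Strategy.move S u' v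

  prefix : (ℕ → V) → ℕ → List V
  prefix π j = map π (upTo j)

  Consistent : {i : Player} → Strategy i → (ℕ → V) → Set
  Consistent {i} S π = ∀ j → owner (π j) ≡ i → π (suc j) ≡ Strategy.move S (prefix π j) (π j)

  Won : (O : (ℕ → V) → Set) → Player → (ℕ → V) → Set
  Won O Fin.zero π = O π
  Won O (Fin.suc _) π = ¬ O π

  WinningFrom : (O : (ℕ → V) → Set) → {i : Player} → Strategy i → V → Set
  WinningFrom O {i} S v = ∀ π → IsPlay π → π 0 ≡ v → Consistent S π → Won O i π

  WinReg : (O : (ℕ → V) → Set) → Player → V → Set
  WinReg O i v = ∃ λ (S : Strategy i) → WinningFrom O S v

  Determined : (O : (ℕ → V) → Set) → Set
  Determined O = ∀ v → (WinReg O Fin.zero v ⊎ WinReg O (Fin.suc Fin.zero) v)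
                     × ¬ (WinReg O Fin.zero v × WinReg O (Fin.suc Fin.zero) v)

  PointwiseMemoryless : (O : (ℕ → V) → Set) → Player → Set
  PointwiseMemoryless O i =
    ∀ v → WinReg O i v → ∃ λ (S : Strategy i) → Memoryless S × WinningFrom O S v

  UniformMemoryless : (O : (ℕ → V) → Set) → Player → Set
  UniformMemoryless O i =
    ∃ λ (S : Strategy i) → Memoryless S × (∀ v → WinReg O i v → WinningFrom O S v)

  PointwiseMemorylessDetermined : (O : (ℕ → V) → Set) → Set
  PointwiseMemorylessDetermined O =
    Determined O × PointwiseMemoryless O Fin.zero × PointwiseMemoryless O (Fin.suc Fin.zero)

  UniformMemorylessDetermined : (O : (ℕ → V) → Set) → Set
  UniformMemorylessDetermined O =
    Determined O × UniformMemoryless O Fin.zero × UniformMemoryless O (Fin.suc Fin.zero)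

  OnePlayer : Set
  OnePlayer = (∀ v → owner v ≡ Fin.suc Fin.zero) ⊎ (∀ v → owner v ≡ Fin.zero)

ClosedUnderCyclicPerm : {U : Set} → (List U → Set) → Set
ClosedUnderCyclicPerm {U} Y = ∀ (a : U) (b : List U) → Y (a ∷ b) → Y (b Data.List.++ (a ∷ []))

module Submission where

-- The whole analysis rests on describing the first cycle by positions: it is popped at
-- the least step j at which π_(j+1) repeats some π_i (FirstCycleAt π j i), so whether a
-- play is won depends only on its prefix π_0 … π_(j+1) and, precisely, on the word of
-- the cycle π_i … π_(j+1) (module FirstCycles).
--
-- (1) If one player owns every vertex, a winning play of the owner is reproduced up to
--     the end of its first cycle by a memoryless strategy (each vertex of the prefix is
--     visited once), and the opponent never moves; determinacy follows classically.
-- (2) A three-vertex one-player arena where a and b are both winning, but with different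
--     moves at b.
-- (3) For Y closed under rotations, the uniform strategy plays at w like the memoryless
--     winning strategy of the least vertex k whose region (vertices reachable from k under
--     that strategy) contains w.  Along a consistent play this least k never increases,
--     so it is constant, say m, on the first cycle.  A simple path from m into the cycle
--     followed by the cycle itself is a lasso consistent with m's strategy, hence won;
--     its first cycle is a rotation of the play's, so the play is won as well (module
--     Lasso, whose index arithmetic lives in CyclicWalk).

open import Defs
open import Level using (0ℓ)
open import Data.List using (List)
open import Data.Product using (Σ; ∃; _×_)
open import Relation.Nullary using (¬_)
open import Axiom.ExcludedMiddle using (ExcludedMiddle)

open import Data.Nat using (ℕ; zero; suc; _+_; _∸_; _<_; _≤_; z≤n; s≤s; _≤?_; _<?_)
open import Data.Nat.Properties
open import Data.Fin as Fin using (Fin; toℕ)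
open import Data.Fin.Properties using (pigeonhole; toℕ-injective)
open import Data.List using ([]; _∷_; _++_; map; drop; upTo; applyUpTo)
open import Data.List.Properties using (map-upTo; map-applyUpTo; upTo-∷ʳ; map-++; ++-assoc; ++-identityʳ)
open import Data.Product using (_,_; proj₁; proj₂)
open import Data.Sum as Sum using (_⊎_; inj₁; inj₂)
open import Data.Empty using (⊥; ⊥-elim)
open import Data.Unit using (⊤; tt)
open import Relation.Nullary using (Dec; yes; no; contradiction)
open import Relation.Binary using (tri<; tri≈; tri>)
open import Relation.Binary.PropositionalEquality

least : ExcludedMiddle 0ℓ → (P : ℕ → Set) → ∀ {k} → P k
      → Σ ℕ λ j → P j × (∀ j' → j' < j → ¬ P j')
least lem P {k} p = search 0 k (λ _ ()) (subst P (sym (+-identityʳ k)) p)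
  where
    -- Invariant: no witness below m, and a witness at d + m.
    search : ∀ m d → (∀ j' → j' < m → ¬ P j') → P (d + m)
           → Σ ℕ λ j → P j × (∀ j' → j' < j → ¬ P j')
    search m d below p with lem {P m}
    ... | yes pm = m , pm , below
    search m zero    below p | no ¬pm = contradiction p ¬pm
    search m (suc d) below p | no ¬pm =
      search (suc m) d below′ (subst P (sym (+-suc d m)) p)
      where
        below′ : ∀ j' → j' < suc m → ¬ P j'
        below′ j' j'<1+m with m≤n⇒m<n∨m≡n (≤-pred j'<1+m)
        ... | inj₁ j'<m = below j' j'<m
        ... | inj₂ refl = ¬pm

rotate : {U : Set} {Y : List U → Set} → ClosedUnderCyclicPerm Y
       → ∀ P Q → Y (P ++ Q) → Y (Q ++ P)
rotate {Y = Y} closed []      Q y = subst Y (sym (++-identityʳ Q)) y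
rotate {Y = Y} closed (a ∷ P) Q y =
  subst Y (++-assoc Q (a ∷ []) P)
    (rotate {Y = Y} closed P (Q ++ a ∷ []) (subst Y (++-assoc P Q (a ∷ [])) (closed a (P ++ Q) y)))

applyUpTo-cong : {X : Set} (h h' : ℕ → X) → ∀ l → (∀ t → t < l → h t ≡ h' t)
               → applyUpTo h l ≡ applyUpTo h' l
applyUpTo-cong h h' zero    eq = refl
applyUpTo-cong h h' (suc l) eq =
  cong₂ _∷_ (eq 0 (s≤s z≤n))
    (applyUpTo-cong (λ t → h (suc t)) (λ t → h' (suc t)) l (λ t t<l → eq (suc t) (s≤s t<l)))

applyUpTo-+ : {X : Set} (h : ℕ → X) → ∀ a b
            → applyUpTo h (a + b) ≡ applyUpTo h a ++ applyUpTo (λ t → h (a + t)) b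
applyUpTo-+ h zero    b = refl
applyUpTo-+ h (suc a) b = cong (h 0 ∷_) (applyUpTo-+ (λ t → h (suc t)) a b)

module FirstCycles {U : Set} (A : Arena U) where
  open Arena A

  walk : (ℕ → V A) → ℕ → List (Edge A)
  walk ρ = applyUpTo (λ t → ρ t , ρ (suc t))

  edgesUpTo-walk : ∀ π j → edgesUpTo A π j ≡ walk π (suc j)
  edgesUpTo-walk π j = map-upTo _ (suc j)

  drop-walk : ∀ i ρ l → drop i (walk ρ l) ≡ walk (λ t → ρ (i + t)) (l ∸ i)
  drop-walk zero    ρ l       = refl
  drop-walk (suc i) ρ zero    = refl
  drop-walk (suc i) ρ (suc l) = drop-walk i (λ t → ρ (suc t)) l

  segment : ∀ π i j → drop i (edgesUpTo A π j) ≡ walk (λ t → π (i + t)) (suc j ∸ i)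
  segment π i j = trans (cong (drop i) (edgesUpTo-walk π j)) (drop-walk i π (suc j))

  walk-cong : ∀ ρ ρ' l → (∀ t → t ≤ l → ρ t ≡ ρ' t) → walk ρ l ≡ walk ρ' l
  walk-cong ρ ρ' l eq =
    applyUpTo-cong _ _ l (λ t t<l → cong₂ _,_ (eq t (<⇒≤ t<l)) (eq (suc t) t<l))

  labels-walk : ∀ ρ l → labels A (walk ρ l) ≡ applyUpTo (λ t → lab (ρ t) (ρ (suc t))) l
  labels-walk ρ l = map-applyUpTo _ _ l

  walk-path→ : ∀ ρ l b → PathFT A (ρ 0) (walk ρ l) b → ρ l ≡ b
  walk-path→ ρ zero    b p       = p
  walk-path→ ρ (suc l) b (_ , p) = walk-path→ (λ t → ρ (suc t)) l b p

  walk-path← : ∀ ρ l b → ρ l ≡ b → PathFT A (ρ 0) (walk ρ l) b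
  walk-path← ρ zero    b e = e
  walk-path← ρ (suc l) b e = refl , walk-path← (λ t → ρ (suc t)) l b e

  segment-cycle→ : ∀ π i j → IsCycle A (drop i (edgesUpTo A π j)) → i ≤ j × π (suc j) ≡ π i
  segment-cycle→ π i j c = ≤-pred i<1+j , closes
    where
      ρ : ℕ → V A
      ρ t = π (i + t)
      nonempty→ : ∀ l → IsCycle A (walk ρ l) → 0 < l × ρ l ≡ ρ 0
      nonempty→ (suc l) c = s≤s z≤n , walk-path→ (λ t → ρ (suc t)) l (ρ 0) c
      cyc : 0 < suc j ∸ i × ρ (suc j ∸ i) ≡ ρ 0
      cyc = nonempty→ (suc j ∸ i) (subst (IsCycle A) (segment π i j) c)
      i<1+j : i < suc j
      i<1+j = m∸n≢0⇒n<m (λ e → <-irrefl (sym e) (proj₁ cyc))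
      closes : π (suc j) ≡ π i
      closes = trans (cong π (sym (m+[n∸m]≡n (<⇒≤ i<1+j))))
                     (trans (proj₂ cyc) (cong π (+-identityʳ i)))

  segment-cycle← : ∀ π i j → i ≤ j → π (suc j) ≡ π i → IsCycle A (drop i (edgesUpTo A π j))
  segment-cycle← π i j i≤j closes =
    subst (IsCycle A) (sym (trans (segment π i j) (cong (walk ρ) (+-∸-assoc 1 i≤j))))
          (walk-path← (λ t → ρ (suc t)) (j ∸ i) (ρ 0) returns)
    where
      ρ : ℕ → V A
      ρ t = π (i + t)
      returns : ρ (suc (j ∸ i)) ≡ ρ 0
      returns = trans (cong π (trans (+-suc i (j ∸ i)) (cong suc (m+[n∸m]≡n i≤j))))
                      (trans closes (cong π (sym (+-identityʳ i))))

  Distinct : (ℕ → V A) → ℕ → Set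
  Distinct ρ j = ∀ a b → a < b → b ≤ j → ρ a ≢ ρ b

  distinct-injective : ∀ {ρ j a b} → Distinct ρ j → a ≤ j → b ≤ j → ρ a ≡ ρ b → a ≡ b
  distinct-injective {a = a} {b} d a≤j b≤j e with <-cmp a b
  ... | tri< a<b _ _ = ⊥-elim (d a b a<b b≤j e)
  ... | tri≈ _ a≡b _ = a≡b
  ... | tri> _ _ b<a = ⊥-elim (d b a b<a a≤j (sym e))

  -- The first cycle of π is popped at step j and starts at position i:
  -- π_0 … π_j are pairwise distinct and π_(j+1) = π_i.
  record FirstCycleAt (π : ℕ → V A) (j i : ℕ) : Set where
    constructor firstCycleAt
    field
      i≤j      : i ≤ j
      closes   : π (suc j) ≡ π i
      distinct : Distinct π j

  cycleWord : (ℕ → V A) → ℕ → ℕ → List U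
  cycleWord π j i = labels A (drop i (edgesUpTo A π j))

  firstCycle→at : ∀ {π u} → FirstCycle A π u
                → Σ ℕ λ j → Σ ℕ λ i → FirstCycleAt π j i × u ≡ drop i (edgesUpTo A π j)
  firstCycle→at {π} (j , (i , u≡ , c) , earlier) with segment-cycle→ π i j (subst (IsCycle A) u≡ c)
  ... | i≤j , closes = j , i , firstCycleAt i≤j closes distinct , u≡
    where
      distinct : Distinct π j
      distinct a (suc b) (s≤s a≤b) b<j e = earlier b b<j a (segment-cycle← π a b a≤b (sym e))

  at→firstCycle : ∀ {π j i} → FirstCycleAt π j i → FirstCycle A π (drop i (edgesUpTo A π j))
  at→firstCycle {π} {j} {i} (firstCycleAt i≤j closes distinct) =
    j , (i , refl , segment-cycle← π i j i≤j closes) , noEarlier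
    where
      noEarlier : ∀ j' → j' < j → ∀ i' → ¬ IsCycle A (drop i' (edgesUpTo A π j'))
      noEarlier j' j'<j i' c with segment-cycle→ π i' j' c
      ... | i'≤j' , closes' = distinct i' (suc j') (s≤s i'≤j') j'<j (sym closes')

  firstCycleAt-unique : ∀ {π j i j' i'} → FirstCycleAt π j i → FirstCycleAt π j' i' → j ≡ j' × i ≡ i'
  firstCycleAt-unique {j = j} {i} {j'} {i'} (firstCycleAt i≤j c d) (firstCycleAt i'≤j' c' d')
    with <-cmp j j'
  ... | tri< j<j' _ _ = ⊥-elim (d' i (suc j) (s≤s i≤j) j<j' (sym c))
  ... | tri> _ _ j'<j = ⊥-elim (d i' (suc j') (s≤s i'≤j') j'<j (sym c'))
  ... | tri≈ _ refl _ = refl , distinct-injective d i≤j i'≤j' (trans (sym c) c')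

  -- Every play has a first cycle: some vertex repeats among π_0 … π_n (pigeonhole),
  -- and the least step closing a cycle is the first one.
  firstCycleAt-exists : ExcludedMiddle 0ℓ → ∀ π → Σ ℕ λ j → Σ ℕ λ i → FirstCycleAt π j i
  firstCycleAt-exists lem π with pigeonhole (n<1+n n) (λ k → π (toℕ k))
  ... | a , b , a<b , e = fromRepeat (toℕ a) (toℕ b) a<b e
    where
      Closing : ℕ → Set
      Closing j = Σ ℕ λ i → i ≤ j × π (suc j) ≡ π i
      fromRepeat : ∀ a b → a < b → π a ≡ π b → Σ ℕ λ j → Σ ℕ λ i → FirstCycleAt π j i
      fromRepeat a (suc b) (s≤s a≤b) e with least lem Closing (a , a≤b , sym e)
      ... | j , (i , i≤j , c) , noEarlier = j , i , firstCycleAt i≤j c distinct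
        where
          distinct : Distinct π j
          distinct a (suc b) (s≤s a≤b) b<j e = noEarlier b b<j (a , a≤b , sym e)

  ofc→word : ∀ {Y π j i} → FirstCycleAt π j i → OFC A Y π → Y (cycleWord π j i)
  ofc→word {Y} D (u , fc , y) with firstCycle→at fc
  ... | _ , _ , D' , u≡ with firstCycleAt-unique D D'
  ... | refl , refl = subst (λ w → Y (labels A w)) u≡ y

  word→ofc : ∀ {Y π j i} → FirstCycleAt π j i → Y (cycleWord π j i) → OFC A Y π
  word→ofc D y = _ , at→firstCycle D , y

  cycleWord-walk : ∀ π j i → cycleWord π j i ≡ applyUpTo (λ t → lab (π (i + t)) (π (i + suc t))) (suc j ∸ i)
  cycleWord-walk π j i = trans (cong (labels A) (segment π i j)) (labels-walk (λ t → π (i + t)) (suc j ∸ i))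

  Visits : (ℕ → V A) → ℕ → ℕ → V A → Set
  Visits π i j x = Σ ℕ λ t → i ≤ t × t ≤ j × π t ≡ x

  ofc-rotation : ∀ {Y} → ClosedUnderCyclicPerm Y → ∀ {π ρ j i k l P Q}
               → FirstCycleAt π j i → FirstCycleAt ρ k l
               → cycleWord π j i ≡ P ++ Q → cycleWord ρ k l ≡ Q ++ P → OFC A Y π → OFC A Y ρ
  ofc-rotation {Y} closed {P = P} {Q} Dπ Dρ π-word ρ-word o =
    word→ofc {Y} Dρ (subst Y (sym ρ-word) (rotate {Y = Y} closed P Q (subst Y π-word (ofc→word {Y} Dπ o))))

  AgreeUpTo : (ℕ → V A) → (ℕ → V A) → ℕ → Set
  AgreeUpTo π π' k = ∀ t → t ≤ k → π t ≡ π' t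

  agree-sym : ∀ {π π' k} → AgreeUpTo π π' k → AgreeUpTo π' π k
  agree-sym ag t t≤k = sym (ag t t≤k)

  firstCycleAt-agree : ∀ {π π' j i} → FirstCycleAt π j i → AgreeUpTo π π' (suc j) → FirstCycleAt π' j i
  firstCycleAt-agree {j = j} (firstCycleAt i≤j c d) ag =
    firstCycleAt i≤j (trans (sym (ag (suc j) ≤-refl)) (trans c (ag _ (m≤n⇒m≤1+n i≤j))))
      (λ a b a<b b≤j e → d a b a<b b≤j
         (trans (ag a (≤-trans (<⇒≤ a<b) (m≤n⇒m≤1+n b≤j))) (trans e (sym (ag b (m≤n⇒m≤1+n b≤j))))))

  cycleWord-agree : ∀ {π π' j} i → AgreeUpTo π π' (suc j) → cycleWord π j i ≡ cycleWord π' j i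
  cycleWord-agree {π} {π'} {j} i ag =
    cong (λ es → labels A (drop i es))
      (trans (edgesUpTo-walk π j) (trans (walk-cong π π' (suc j) ag) (sym (edgesUpTo-walk π' j))))

  ofc-agree : ∀ {Y π π' j i} → FirstCycleAt π j i → AgreeUpTo π π' (suc j) → OFC A Y π → OFC A Y π'
  ofc-agree {Y} {i = i} D ag o =
    word→ofc {Y} (firstCycleAt-agree D ag) (subst Y (cycleWord-agree i ag) (ofc→word {Y} D o))

opponent : Player → Player
opponent Fin.zero    = Fin.suc Fin.zero
opponent (Fin.suc _) = Fin.zero

opponent-≢ : ∀ i → opponent i ≢ i
opponent-≢ Fin.zero ()
opponent-≢ (Fin.suc Fin.zero) ()

module WinningPlays {U : Set} (A : Arena U) (O : (ℕ → V A) → Set) where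

  won-respects : ∀ i {π π'} → (O π → O π') → (O π' → O π) → Won A O i π → Won A O i π'
  won-respects Fin.zero    to from w = to w
  won-respects (Fin.suc _) to from w = λ o → w (from o)

  won-exclusive : ∀ i {π} → Won A O i π → ¬ Won A O (opponent i) π
  won-exclusive Fin.zero    w w' = w' w
  won-exclusive (Fin.suc _) w w' = w w'

  won-opponent : ExcludedMiddle 0ℓ → ∀ i {π} → ¬ Won A O i π → Won A O (opponent i) π
  won-opponent lem Fin.zero    ¬w = ¬w
  won-opponent lem (Fin.suc _) {π} ¬w with lem {O π}
  ... | yes o = o
  ... | no ¬o = ⊥-elim (¬w ¬o)

module Strategies {U : Set} (A : Arena U) where
  open Arena A

  defaultStrategy : ∀ i → Strategy A i
  defaultStrategy i = record { move = λ _ v → proj₁ (total v) ; legal = λ _ v _ → proj₂ (total v) }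

  defaultStrategy-memoryless : ∀ i → Memoryless A (defaultStrategy i)
  defaultStrategy-memoryless i _ _ _ _ = refl

  module Outcome {i : Player} (S : Strategy A i) where
    open Strategy S

    -- history v t = (the first t vertices, the current vertex)
    history : V A → ℕ → List (V A) × V A
    history v zero    = [] , v
    history v (suc t) = let (h , w) = history v t in (h ++ w ∷ []) , move h w

    outcome : V A → ℕ → V A
    outcome v t = proj₂ (history v t)

    history-prefix : ∀ v t → proj₁ (history v t) ≡ prefix A (outcome v) t
    history-prefix v zero    = refl
    history-prefix v (suc t) =
      trans (cong (_++ outcome v t ∷ []) (history-prefix v t)) (sym (prefix-suc (outcome v) t))
      where
        prefix-suc : ∀ π t → prefix A π (suc t) ≡ prefix A π t ++ π t ∷ []
        prefix-suc π t = trans (cong (map π) (sym (upTo-∷ʳ t))) (map-++ π (upTo t) (t ∷ []))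

    outcome-consistent : ∀ v → Consistent A S (outcome v)
    outcome-consistent v t _ = cong (λ h → move h (outcome v t)) (history-prefix v t)

    outcome-play : (∀ w → owner w ≡ i) → ∀ v → IsPlay A (outcome v)
    outcome-play owns v t = legal (proj₁ (history v t)) (outcome v t) (owns _)

  opponent-consistent : ∀ {i} → (∀ w → owner w ≡ i) → (S : Strategy A (opponent i)) → ∀ π → Consistent A S π
  opponent-consistent {i} owns S π t o = ⊥-elim (opponent-≢ i (trans (sym o) (owns (π t))))

module OnePlayerGames (lem : ExcludedMiddle 0ℓ) {U : Set} (A : Arena U) (Y : List U → Set)
                      (i : Player) (owns : ∀ w → Arena.owner A w ≡ i) where
  open Arena A
  open FirstCycles A
  open Strategies A
  open WinningPlays A (OFC A Y)

  O : (ℕ → V A) → Set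
  O = OFC A Y

  -- The owner can copy any play π up to the end of its first cycle with a memoryless
  -- strategy: at π_t (t ≤ j) move to π_(t+1); this is well defined as π_0 … π_j are distinct.
  copy : ∀ π {j k} → IsPlay A π → FirstCycleAt π j k
       → Σ (Strategy A i) λ S → Memoryless A S
           × (∀ π' → π' 0 ≡ π 0 → Consistent A S π' → AgreeUpTo π π' (suc j))
  copy π {j} isPlay D = S , (λ _ _ _ _ → refl) , agree
    where
      choose : ∀ w → Dec (Visits π 0 j w) → V A
      choose w (yes (t , _ , _ , _)) = π (suc t)
      choose w (no _)                = proj₁ (total w)
      choose-legal : ∀ w d → E w (choose w d)
      choose-legal w (yes (t , _ , _ , refl)) = isPlay t
      choose-legal w (no _)                   = proj₂ (total w)
      choose-visited : ∀ t → t ≤ j → ∀ d → choose (π t) d ≡ π (suc t)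
      choose-visited t t≤j (yes (t' , _ , t'≤j , e)) =
        cong (λ x → π (suc x)) (distinct-injective (FirstCycleAt.distinct D) t'≤j t≤j e)
      choose-visited t t≤j (no unvisited) = ⊥-elim (unvisited (t , z≤n , t≤j , refl))
      S : Strategy A i
      S = record { move = λ _ w → choose w lem ; legal = λ _ w _ → choose-legal w lem }
      agree : ∀ π' → π' 0 ≡ π 0 → Consistent A S π' → AgreeUpTo π π' (suc j)
      agree π' start cons zero    _         = sym start
      agree π' start cons (suc t) (s≤s t≤j) =
        trans (sym (choose-visited t t≤j lem))
              (trans (cong (λ x → choose x lem) (agree π' start cons t (m≤n⇒m≤1+n t≤j)))
                     (sym (cons t (owns _))))

  copy-wins : ∀ π {v} → IsPlay A π → π 0 ≡ v → Won A O i π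
            → Σ (Strategy A i) λ S → Memoryless A S × WinningFrom A O S v
  copy-wins π {v} isPlay start won with firstCycleAt-exists lem π
  ... | j , k , D with copy π isPlay D
  ... | S , memoryless , agree = S , memoryless , winning
    where
      winning : WinningFrom A O S v
      winning π' _ start' cons =
        won-respects i (ofc-agree {Y} D ag) (ofc-agree {Y} (firstCycleAt-agree D ag) (agree-sym ag)) won
        where
          ag : AgreeUpTo π π' (suc j)
          ag = agree π' (trans start' (sym start)) cons

  owner-memoryless : PointwiseMemoryless A O i
  owner-memoryless v (S , winning) =
    copy-wins (outcome v) (outcome-play owns v) refl
              (winning (outcome v) (outcome-play owns v) refl (outcome-consistent v))
    where open Outcome S

  -- The opponent never moves, so the default strategy is as good as any.
  opponent-memoryless : PointwiseMemoryless A O (opponent i)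
  opponent-memoryless v (S , winning) =
    defaultStrategy _ , defaultStrategy-memoryless _ ,
    λ π isPlay start _ → winning π isPlay start (opponent-consistent owns S π)

  -- The owner wins from v iff some play from v is won by the owner.
  determined : ∀ v → (WinReg A O i v ⊎ WinReg A O (opponent i) v)
                   × ¬ (WinReg A O i v × WinReg A O (opponent i) v)
  determined v = winner lem , exclusive
    where
      winner : Dec (Σ (ℕ → V A) λ π → IsPlay A π × π 0 ≡ v × Won A O i π)
             → WinReg A O i v ⊎ WinReg A O (opponent i) v
      winner (yes (π , isPlay , start , won)) =
        inj₁ (let (S , _ , winning) = copy-wins π isPlay start won in S , winning)
      winner (no none) =
        inj₂ (defaultStrategy _ , λ π isPlay start _ →
                won-opponent lem i (λ won → none (π , isPlay , start , won)))
      exclusive : ¬ (WinReg A O i v × WinReg A O (opponent i) v)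
      exclusive ((S , winning) , (S' , winning')) =
        won-exclusive i (winning π isPlay refl (outcome-consistent v))
                        (winning' π isPlay refl (opponent-consistent owns S' π))
        where
          open Outcome S
          π : ℕ → V A
          π = outcome v
          isPlay : IsPlay A π
          isPlay = outcome-play owns v

onePlayer-memorylessDetermined : ExcludedMiddle 0ℓ → {U : Set} (Y : List U → Set) (A : Arena U)
                               → OnePlayer A → PointwiseMemorylessDetermined A (OFC A Y)
onePlayer-memorylessDetermined lem Y A (inj₁ owns₁) =
  (λ v → swapWinner (determined v)) , opponent-memoryless , owner-memoryless
  where
    open OnePlayerGames lem A Y (Fin.suc Fin.zero) owns₁
    swapWinner : ∀ {P Q : Set} → (P ⊎ Q) × ¬ (P × Q) → (Q ⊎ P) × ¬ (Q × P)
    swapWinner (w , excl) = Sum.swap w , λ (q , p) → excl (p , q)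
onePlayer-memorylessDetermined lem Y A (inj₂ owns₀) = determined , owner-memoryless , opponent-memoryless
  where open OnePlayerGames lem A Y Fin.zero owns₀

module ShortCycles {U : Set} (A : Arena U) where
  open Arena A
  open FirstCycles A

  twoCycle : ∀ {π a b} → π 0 ≡ a → π 1 ≡ b → π 2 ≡ a → a ≢ b
           → FirstCycleAt π 1 0 × cycleWord π 1 0 ≡ lab a b ∷ lab b a ∷ []
  twoCycle {π} {a} {b} e₀ e₁ e₂ a≢b = firstCycleAt z≤n (trans e₂ (sym e₀)) distinct , word
    where
      distinct : Distinct π 1
      distinct 0 1 _ _ e = a≢b (trans (sym e₀) (trans e e₁))
      distinct (suc _) 1 (s≤s ()) _
      distinct _ (suc (suc _)) _ (s≤s ())
      word : cycleWord π 1 0 ≡ lab a b ∷ lab b a ∷ []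
      word rewrite e₀ | e₁ | e₂ = refl

  threeCycle : ∀ {π a b c} → π 0 ≡ a → π 1 ≡ b → π 2 ≡ c → π 3 ≡ a → a ≢ b → a ≢ c → b ≢ c
             → FirstCycleAt π 2 0 × cycleWord π 2 0 ≡ lab a b ∷ lab b c ∷ lab c a ∷ []
  threeCycle {π} {a} {b} {c} e₀ e₁ e₂ e₃ a≢b a≢c b≢c = firstCycleAt z≤n (trans e₃ (sym e₀)) distinct , word
    where
      distinct : Distinct π 2
      distinct 0 1 _ _ e = a≢b (trans (sym e₀) (trans e e₁))
      distinct 0 2 _ _ e = a≢c (trans (sym e₀) (trans e e₂))
      distinct 1 2 _ _ e = b≢c (trans (sym e₁) (trans e e₂))
      distinct (suc _) 1 (s≤s ()) _
      distinct (suc (suc _)) 2 (s≤s (s≤s ())) _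
      distinct _ (suc (suc (suc _))) _ (s≤s (s≤s ()))
      word : cycleWord π 2 0 ≡ lab a b ∷ lab b c ∷ lab c a ∷ []
      word rewrite e₀ | e₁ | e₂ | e₃ = refl

-- From a the winning cycle is a b a, from b
-- it is b c a b; a uniform memoryless strategy must fix one move at b and loses from
-- a or from b.
module Counterexample where

  pattern a = Fin.zero
  pattern b = Fin.suc Fin.zero
  pattern c = Fin.suc (Fin.suc Fin.zero)

  Edge₃ : Fin 3 → Fin 3 → Set
  Edge₃ a b = ⊤
  Edge₃ b a = ⊤
  Edge₃ b c = ⊤
  Edge₃ c a = ⊤
  Edge₃ _ _ = ⊥

  label₃ : Fin 3 → Fin 3 → ℕ
  label₃ a b = 0
  label₃ b a = 1
  label₃ b c = 2
  label₃ c a = 3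
  label₃ _ _ = 0

  successor₃ : ∀ v → Σ (Fin 3) (Edge₃ v)
  successor₃ a = b , tt
  successor₃ b = a , tt
  successor₃ c = a , tt

  A₃ : Arena ℕ
  A₃ = record { n = 3 ; nonempty = s≤s z≤n ; owner = λ _ → Fin.zero
              ; E = Edge₃ ; total = successor₃ ; lab = label₃ }

  Y₃ : List ℕ → Set
  Y₃ w = w ≡ 0 ∷ 1 ∷ [] ⊎ w ≡ 2 ∷ 3 ∷ 0 ∷ []

  open FirstCycles A₃
  open ShortCycles A₃
  open Strategies A₃

  O : (ℕ → Fin 3) → Set
  O = OFC A₃ Y₃

  from-a : ∀ {x y} → x ≡ a → Edge₃ x y → y ≡ b
  from-a {a} {b} _ _ = refl
  from-c : ∀ {x y} → x ≡ c → Edge₃ x y → y ≡ a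
  from-c {c} {a} _ _ = refl

  atB : (y : Fin 3) → Edge₃ b y → Strategy A₃ Fin.zero
  atB y e = record { move = λ _ v → next v ; legal = λ _ v _ → next-legal v }
    where
      next : Fin 3 → Fin 3
      next b = y
      next v = proj₁ (successor₃ v)
      next-legal : ∀ v → Edge₃ v (next v)
      next-legal a = tt
      next-legal b = e
      next-legal c = tt

  -- Moving b → a wins from a: the first cycle is a b a, labelled 01.
  winsFrom-a : WinningFrom A₃ O (atB a tt) a
  winsFrom-a π _ e₀ cons =
    let (D , word) = twoCycle {π} e₀ e₁ e₂ (λ ()) in word→ofc {Y₃} D (subst Y₃ (sym word) (inj₁ refl))
    where
      move : Fin 3 → Fin 3
      move = Strategy.move (atB a tt) []
      e₁ : π 1 ≡ b
      e₁ = trans (cons 0 refl) (cong move e₀)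
      e₂ : π 2 ≡ a
      e₂ = trans (cons 1 refl) (cong move e₁)

  -- Moving b → c wins from b: the first cycle is b c a b, labelled 230.
  winsFrom-b : WinningFrom A₃ O (atB c tt) b
  winsFrom-b π _ e₀ cons =
    let (D , word) = threeCycle {π} e₀ e₁ e₂ e₃ (λ ()) (λ ()) (λ ())
    in word→ofc {Y₃} D (subst Y₃ (sym word) (inj₂ refl))
    where
      move : Fin 3 → Fin 3
      move = Strategy.move (atB c tt) []
      e₁ : π 1 ≡ c
      e₁ = trans (cons 0 refl) (cong move e₀)
      e₂ : π 2 ≡ a
      e₂ = trans (cons 1 refl) (cong move e₁)
      e₃ : π 3 ≡ b
      e₃ = trans (cons 2 refl) (cong move e₂)

  ¬Y₃-10 : ¬ Y₃ (1 ∷ 0 ∷ [])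
  ¬Y₃-10 (inj₁ ())
  ¬Y₃-10 (inj₂ ())

  ¬Y₃-023 : ¬ Y₃ (0 ∷ 2 ∷ 3 ∷ [])
  ¬Y₃-023 (inj₁ ())
  ¬Y₃-023 (inj₂ ())

  -- A memoryless strategy winning from both a and b must choose its move at b;
  -- b → a loses from b (first cycle b a b, labelled 10), b → c loses from a
  -- (first cycle a b c a, labelled 023).
  not-uniform : ¬ UniformMemorylessDetermined A₃ O
  not-uniform (_ , (S , memoryless , winning) , _) = loses (move [] b) refl (legal [] b refl)
    where
      open Strategy S
      open Outcome S
      isPlay : ∀ v → IsPlay A₃ (outcome v)
      isPlay = outcome-play (λ _ → refl)
      next : ∀ v t → outcome v (suc t) ≡ move [] (outcome v t)
      next v t = trans (outcome-consistent v t refl) (memoryless _ [] _ refl)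
      won : ∀ v → WinReg A₃ O Fin.zero v → O (outcome v)
      won v w = winning v w (outcome v) (isPlay v) refl (outcome-consistent v)
      b→a-loses : move [] b ≡ a → ⊥
      b→a-loses chosen =
        let (D , word) = twoCycle {outcome b} refl e₁ e₂ (λ ()) in
        ¬Y₃-10 (subst Y₃ word (ofc→word {Y₃} D (won b (atB c tt , winsFrom-b))))
        where
          e₁ : outcome b 1 ≡ a
          e₁ = trans (next b 0) chosen
          e₂ : outcome b 2 ≡ b
          e₂ = from-a e₁ (isPlay b 1)
      b→c-loses : move [] b ≡ c → ⊥
      b→c-loses chosen =
        let (D , word) = threeCycle {outcome a} refl e₁ e₂ e₃ (λ ()) (λ ()) (λ ()) in
        ¬Y₃-023 (subst Y₃ word (ofc→word {Y₃} D (won a (atB a tt , winsFrom-a))))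
        where
          e₁ : outcome a 1 ≡ b
          e₁ = from-a refl (isPlay a 0)
          e₂ : outcome a 2 ≡ c
          e₂ = trans (next a 1) (trans (cong (move []) e₁) chosen)
          e₃ : outcome a 3 ≡ a
          e₃ = from-c e₂ (isPlay a 2)
      loses : ∀ y → move [] b ≡ y → Edge₃ b y → ⊥
      loses a chosen _ = b→a-loses chosen
      loses c chosen _ = b→c-loses chosen

  counterexample : Σ Set λ U → Σ (List U → Set) λ Y → Σ (Arena U) λ A
                 → OnePlayer A × ¬ UniformMemorylessDetermined A (OFC A Y)
  counterexample = ℕ , Y₃ , A₃ , inj₂ (λ _ → refl) , not-uniform

-- Walking cyclically through the positions i₀ … j (after j comes i₀ again), starting at r.
module CyclicWalk (i₀ r j : ℕ) (i₀≤r : i₀ ≤ r) (r≤j : r ≤ j) where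

  -- From r it takes d steps to reach j; from i₀ it takes e steps to reach r;
  -- the cycle has suc c positions.
  d e c : ℕ
  d = j ∸ r
  e = r ∸ i₀
  c = j ∸ i₀

  r+d≡j : r + d ≡ j
  r+d≡j = m+[n∸m]≡n r≤j

  i₀+e≡r : i₀ + e ≡ r
  i₀+e≡r = m+[n∸m]≡n i₀≤r

  c≡d+e : c ≡ d + e
  c≡d+e = begin
    j ∸ i₀              ≡⟨ cong (_∸ i₀) j≡ ⟩
    i₀ + (e + d) ∸ i₀   ≡⟨ m+n∸m≡n i₀ (e + d) ⟩
    e + d               ≡⟨ +-comm e d ⟩
    d + e               ∎
    where
      open ≡-Reasoning
      j≡ : j ≡ i₀ + (e + d)
      j≡ = trans (sym r+d≡j) (trans (cong (_+ d) (sym i₀+e≡r)) (+-assoc i₀ e d))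

  next : ℕ → ℕ
  next x = step (x <? j)
    where
      step : Dec (x < j) → ℕ
      step (yes _) = suc x
      step (no _)  = i₀

  next-< : ∀ x → x < j → next x ≡ suc x
  next-< x x<j with x <? j
  ... | yes _   = refl
  ... | no x≮j  = ⊥-elim (x≮j x<j)

  next-j : next j ≡ i₀
  next-j with j <? j
  ... | yes j<j = ⊥-elim (<-irrefl refl j<j)
  ... | no _    = refl

  position : ℕ → ℕ
  position zero    = r
  position (suc s) = next (position s)

  position-range : ∀ s → i₀ ≤ position s × position s ≤ j
  position-range zero    = i₀≤r , r≤j
  position-range (suc s) with position-range s
  ... | i₀≤x , x≤j with m≤n⇒m<n∨m≡n x≤j
  ...   | inj₁ x<j  = subst (λ y → i₀ ≤ y × y ≤ j) (sym (next-< _ x<j)) (m≤n⇒m≤1+n i₀≤x , x<j)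
  ...   | inj₂ x≡j = subst (λ y → i₀ ≤ y × y ≤ j) (sym (trans (cong next x≡j) next-j))
                              (≤-refl , ≤-trans i₀≤r r≤j)

  position-first : ∀ s → s ≤ d → position s ≡ r + s
  position-first zero    _   = sym (+-identityʳ r)
  position-first (suc s) s<d = begin
    next (position s)  ≡⟨ cong next (position-first s (<⇒≤ s<d)) ⟩
    next (r + s)       ≡⟨ next-< (r + s) (subst (r + s <_) r+d≡j (+-monoʳ-< r s<d)) ⟩
    suc (r + s)        ≡⟨ sym (+-suc r s) ⟩
    r + suc s          ∎
    where open ≡-Reasoning

  position-second : ∀ s → s ≤ e → position (suc d + s) ≡ i₀ + s
  position-second zero _ = begin
    position (suc d + 0)  ≡⟨ cong (λ x → next (position x)) (+-identityʳ d) ⟩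
    next (position d)     ≡⟨ cong next (trans (position-first d ≤-refl) r+d≡j) ⟩
    next j                ≡⟨ next-j ⟩
    i₀                    ≡⟨ sym (+-identityʳ i₀) ⟩
    i₀ + 0                ∎
    where open ≡-Reasoning
  position-second (suc s) s<e = begin
    position (suc d + suc s)  ≡⟨ cong position (+-suc (suc d) s) ⟩
    next (position (suc d + s)) ≡⟨ cong next (position-second s (<⇒≤ s<e)) ⟩
    next (i₀ + s)             ≡⟨ next-< (i₀ + s) (<-≤-trans (i₀+s<r s<e) r≤j) ⟩
    suc (i₀ + s)              ≡⟨ sym (+-suc i₀ s) ⟩
    i₀ + suc s                ∎
    where
      open ≡-Reasoning
      i₀+s<r : ∀ {s} → s < e → i₀ + s < r
      i₀+s<r s<e = subst (i₀ + _ <_) i₀+e≡r (+-monoʳ-< i₀ s<e)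

  position-period : position (suc c) ≡ r
  position-period = begin
    position (suc c)      ≡⟨ cong (λ x → position (suc x)) c≡d+e ⟩
    position (suc d + e)  ≡⟨ position-second e ≤-refl ⟩
    i₀ + e                ≡⟨ i₀+e≡r ⟩
    r                     ∎
    where open ≡-Reasoning

  index : ℕ → ℕ
  index x = steps (r ≤? x)
    where
      steps : Dec (r ≤ x) → ℕ
      steps (yes _) = x ∸ r
      steps (no _)  = suc d + (x ∸ i₀)

  index-≥ : ∀ x → r ≤ x → index x ≡ x ∸ r
  index-≥ x r≤x with r ≤? x
  ... | yes _   = refl
  ... | no r≰x  = ⊥-elim (r≰x r≤x)

  index-< : ∀ x → x < r → index x ≡ suc d + (x ∸ i₀)
  index-< x x<r with r ≤? x
  ... | yes r≤x = ⊥-elim (<⇒≱ x<r r≤x)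
  ... | no _    = refl

  index-first : ∀ s → s ≤ d → index (position s) ≡ s
  index-first s s≤d = begin
    index (position s)  ≡⟨ cong index (position-first s s≤d) ⟩
    index (r + s)       ≡⟨ index-≥ (r + s) (m≤m+n r s) ⟩
    r + s ∸ r           ≡⟨ m+n∸m≡n r s ⟩
    s                   ∎
    where open ≡-Reasoning

  index-second : ∀ s → s < e → index (position (suc d + s)) ≡ suc d + s
  index-second s s<e = begin
    index (position (suc d + s))  ≡⟨ cong index (position-second s (<⇒≤ s<e)) ⟩
    index (i₀ + s)                ≡⟨ index-< (i₀ + s) (subst (i₀ + s <_) i₀+e≡r (+-monoʳ-< i₀ s<e)) ⟩
    suc d + (i₀ + s ∸ i₀)         ≡⟨ cong (suc d +_) (m+n∸m≡n i₀ s) ⟩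
    suc d + s                     ∎
    where open ≡-Reasoning

  -- index is a left inverse of position on one round, so the round visits no position twice.
  index-position : ∀ s → s ≤ c → index (position s) ≡ s
  index-position s s≤c with s ≤? d
  ... | yes s≤d = index-first s s≤d
  ... | no s≰d  = subst (λ x → index (position x) ≡ x) s≡ (index-second (s ∸ suc d) s'<e)
    where
      s≡ : suc d + (s ∸ suc d) ≡ s
      s≡ = m+[n∸m]≡n (≰⇒> s≰d)
      s'<e : s ∸ suc d < e
      s'<e = +-cancelˡ-≤ d (suc (s ∸ suc d)) e
               (≤-trans (≤-reflexive (trans (+-suc d (s ∸ suc d)) s≡)) (subst (s ≤_) c≡d+e s≤c))

  position-injective : ∀ {s s'} → s ≤ c → s' ≤ c → position s ≡ position s' → s ≡ s'
  position-injective {s} {s'} s≤c s'≤c eq =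
    trans (sym (index-position s s≤c)) (trans (cong index eq) (index-position s' s'≤c))

  round-split : {X : Set} (ℓ : ℕ → X)
              → applyUpTo (λ t → ℓ (position t)) (suc c)
              ≡ applyUpTo (λ t → ℓ (r + t)) (suc d) ++ applyUpTo (λ t → ℓ (i₀ + t)) e
  round-split ℓ = begin
    applyUpTo (λ t → ℓ (position t)) (suc c)
      ≡⟨ cong (λ x → applyUpTo (λ t → ℓ (position t)) (suc x)) c≡d+e ⟩
    applyUpTo (λ t → ℓ (position t)) (suc d + e)
      ≡⟨ applyUpTo-+ (λ t → ℓ (position t)) (suc d) e ⟩
    applyUpTo (λ t → ℓ (position t)) (suc d) ++ applyUpTo (λ t → ℓ (position (suc d + t))) e
      ≡⟨ cong₂ _++_ (applyUpTo-cong _ _ (suc d) (λ t t<1+d → cong ℓ (position-first t (≤-pred t<1+d))))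
                    (applyUpTo-cong _ _ e (λ t t<e → cong ℓ (position-second t (<⇒≤ t<e)))) ⟩
    applyUpTo (λ t → ℓ (r + t)) (suc d) ++ applyUpTo (λ t → ℓ (i₀ + t)) e
      ∎
    where open ≡-Reasoning

  segment-split : {X : Set} (ℓ : ℕ → X)
                → applyUpTo (λ t → ℓ (i₀ + t)) (suc c)
                ≡ applyUpTo (λ t → ℓ (i₀ + t)) e ++ applyUpTo (λ t → ℓ (r + t)) (suc d)
  segment-split ℓ = begin
    applyUpTo (λ t → ℓ (i₀ + t)) (suc c)
      ≡⟨ cong (applyUpTo (λ t → ℓ (i₀ + t))) 1+c≡e+1+d ⟩
    applyUpTo (λ t → ℓ (i₀ + t)) (e + suc d)
      ≡⟨ applyUpTo-+ (λ t → ℓ (i₀ + t)) e (suc d) ⟩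
    applyUpTo (λ t → ℓ (i₀ + t)) e ++ applyUpTo (λ t → ℓ (i₀ + (e + t))) (suc d)
      ≡⟨ cong (applyUpTo (λ t → ℓ (i₀ + t)) e ++_)
              (applyUpTo-cong _ _ (suc d) (λ t _ → cong ℓ (trans (sym (+-assoc i₀ e t)) (cong (_+ t) i₀+e≡r)))) ⟩
    applyUpTo (λ t → ℓ (i₀ + t)) e ++ applyUpTo (λ t → ℓ (r + t)) (suc d)
      ∎
    where
      open ≡-Reasoning
      1+c≡e+1+d : suc c ≡ e + suc d
      1+c≡e+1+d = trans (cong suc (trans c≡d+e (+-comm d e))) (sym (+-suc e d))

module SimplePaths (lem : ExcludedMiddle 0ℓ) {U : Set} (A : Arena U) (R : V A → V A → Set) where
  open FirstCycles A

  data Reachable (k : V A) : V A → Set where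
    here : Reachable k k
    _▷_  : ∀ {x y} → Reachable k x → R x y → Reachable k y

  record SimplePath (k : V A) : Set where
    constructor simplePath
    field
      len      : ℕ
      path     : ℕ → V A
      starts   : path 0 ≡ k
      steps    : ∀ t → t < len → R (path t) (path (suc t))
      distinct : Distinct path len

    end : V A
    end = path len

  open SimplePath

  truncate : ∀ {k} (P : SimplePath k) a → a ≤ len P → SimplePath k
  truncate (simplePath L p s st d) a a≤L =
    simplePath a p s (λ t t<a → st t (<-≤-trans t<a a≤L)) (λ x y x<y y≤a → d x y x<y (≤-trans y≤a a≤L))

  extend : ∀ {k y} (P : SimplePath k) → R (end P) y → (∀ a → a ≤ len P → path P a ≢ y)
         → Σ (SimplePath k) λ P' → end P' ≡ y
  extend {y = y} (simplePath L p s st d) r fresh = simplePath (suc L) q (trans (q-≤ 0 z≤n) s) st' d' , q-end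
    where
      choose : ∀ t → Dec (t ≤ L) → V A
      choose t (yes _) = p t
      choose t (no _)  = y
      q : ℕ → V A
      q t = choose t (t ≤? L)
      q-≤ : ∀ t → t ≤ L → q t ≡ p t
      q-≤ t t≤L with t ≤? L
      ... | yes _   = refl
      ... | no t≰L  = ⊥-elim (t≰L t≤L)
      q-end : q (suc L) ≡ y
      q-end with suc L ≤? L
      ... | yes 1+L≤L = ⊥-elim (<-irrefl refl 1+L≤L)
      ... | no _      = refl
      st' : ∀ t → t < suc L → R (q t) (q (suc t))
      st' t (s≤s t≤L) with m≤n⇒m<n∨m≡n t≤L
      ... | inj₁ t<L  = subst₂ R (sym (q-≤ t t≤L)) (sym (q-≤ (suc t) t<L)) (st t t<L)
      ... | inj₂ refl = subst₂ R (sym (q-≤ t t≤L)) (sym q-end) r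
      d' : Distinct q (suc L)
      d' a b a<b b≤1+L e with m≤n⇒m<n∨m≡n b≤1+L
      ... | inj₁ (s≤s b≤L) = d a b a<b b≤L (trans (sym (q-≤ a (≤-trans (<⇒≤ a<b) b≤L))) (trans e (q-≤ b b≤L)))
      ... | inj₂ refl      = fresh a (≤-pred a<b) (trans (sym (q-≤ a (≤-pred a<b))) (trans e q-end))

  -- Every reachable vertex is the end of a simple path: if the new vertex is already
  -- on the path, cut the path there, otherwise extend it.
  simplify : ∀ {k y} → Reachable k y → Σ (SimplePath k) λ P → end P ≡ y
  simplify {k} here = simplePath 0 (λ _ → k) refl (λ _ ()) (λ a b a<b b≤0 → ⊥-elim (<⇒≱ (<-≤-trans a<b b≤0) z≤n)) , refl
  simplify {y = y} (reach ▷ r) with simplify reach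
  ... | P , P-end with lem {Σ ℕ λ a → a ≤ len P × path P a ≡ y}
  ...   | yes (a , a≤L , pa≡y) = truncate P a a≤L , pa≡y
  ...   | no fresh = extend P (subst (λ x → R x y) (sym P-end) r) (λ a a≤L e → fresh (a , a≤L , e))

  firstEntry : ∀ {k} (X : V A → Set) (P : SimplePath k) → X (end P)
             → Σ (SimplePath k) λ P' → X (end P') × (∀ a → a < len P' → ¬ X (path P' a))
  firstEntry X P x with least lem (λ a → a ≤ len P × X (path P a)) (≤-refl , x)
  ... | a , (a≤L , xa) , before = truncate P a a≤L , xa ,
                                 λ b b<a xb → before b b<a (≤-trans (<⇒≤ b<a) a≤L , xb)

-- Let π be a play whose first cycle spans the positions i₀ … j, and let
-- p_0 … p_L be a simple path that meets this cycle only at its end p_L = π_r.  The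
-- lasso ρ follows p and then goes round the cycle forever, starting at π_r.  Its first
-- cycle is the cycle of π, entered at π_r, so its word is a rotation of π's.
module Lasso {U : Set} (A : Arena U) {π : ℕ → V A} {j i₀ : ℕ} (D : FirstCycles.FirstCycleAt A π j i₀)
             (r : ℕ) (i₀≤r : i₀ ≤ r) (r≤j : r ≤ j)
             (L : ℕ) (p : ℕ → V A) (p-distinct : FirstCycles.Distinct A p L) (p-end : p L ≡ π r)
             (p-avoids : ∀ a → a < L → ¬ FirstCycles.Visits A π i₀ j (p a)) where
  open Arena A
  open FirstCycles A
  open CyclicWalk i₀ r j i₀≤r r≤j

  ρ : ℕ → V A
  ρ t = choose (t ≤? L)
    where
      choose : Dec (t ≤ L) → V A
      choose (yes _) = p t
      choose (no _)  = π (position (t ∸ L))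

  ρ-prefix : ∀ t → t ≤ L → ρ t ≡ p t
  ρ-prefix t t≤L with t ≤? L
  ... | yes _  = refl
  ... | no t≰L = ⊥-elim (t≰L t≤L)

  ρ-suffix : ∀ t → L < t → ρ t ≡ π (position (t ∸ L))
  ρ-suffix t L<t with t ≤? L
  ... | yes t≤L = ⊥-elim (<⇒≱ L<t t≤L)
  ... | no _    = refl

  ρ-cycle : ∀ s → ρ (L + s) ≡ π (position s)
  ρ-cycle zero    = trans (ρ-prefix (L + 0) (≤-reflexive (+-identityʳ L))) (trans (cong p (+-identityʳ L)) p-end)
  ρ-cycle (suc s) = trans (ρ-suffix (L + suc s) (m<m+n L (s≤s z≤n)))
                          (cong (λ x → π (position x)) (m+n∸m≡n L (suc s)))

  ρ-beyond : ∀ t → L ≤ t → ρ t ≡ π (position (t ∸ L))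
  ρ-beyond t L≤t = trans (cong ρ (sym (m+[n∸m]≡n L≤t))) (ρ-cycle (t ∸ L))

  π-next : ∀ x → x ≤ j → π (next x) ≡ π (suc x)
  π-next x x≤j with m≤n⇒m<n∨m≡n x≤j
  ... | inj₁ x<j = cong π (next-< x x<j)
  ... | inj₂ x≡j = trans (cong π (trans (cong next x≡j) next-j))
                         (trans (sym (FirstCycleAt.closes D)) (cong (λ y → π (suc y)) (sym x≡j)))

  ρ-steps : (R : V A → V A → Set)
          → (∀ t → t < L → R (p t) (p (suc t)))
          → (∀ x → i₀ ≤ x → x ≤ j → R (π x) (π (suc x)))
          → ∀ t → R (ρ t) (ρ (suc t))
  ρ-steps R p-steps π-steps t = split (t <? L)
    where
      cycle-step : ∀ s → R (ρ (L + s)) (ρ (suc (L + s)))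
      cycle-step s =
        subst₂ R (sym (ρ-cycle s))
                 (trans (sym (π-next x x≤j)) (sym (trans (cong ρ (sym (+-suc L s))) (ρ-cycle (suc s)))))
                 (π-steps x i₀≤x x≤j)
        where
          x : ℕ
          x = position s
          i₀≤x : i₀ ≤ x
          i₀≤x = proj₁ (position-range s)
          x≤j : x ≤ j
          x≤j = proj₂ (position-range s)
      split : Dec (t < L) → R (ρ t) (ρ (suc t))
      split (yes t<L) = subst₂ R (sym (ρ-prefix t (<⇒≤ t<L))) (sym (ρ-prefix (suc t) t<L)) (p-steps t t<L)
      split (no t≮L)  = subst (λ t → R (ρ t) (ρ (suc t))) (m+[n∸m]≡n (≮⇒≥ t≮L)) (cycle-step (t ∸ L))

  K : ℕ
  K = L + c

  ρ-closes : ρ (suc K) ≡ ρ L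
  ρ-closes = begin
    ρ (suc (L + c))     ≡⟨ cong ρ (sym (+-suc L c)) ⟩
    ρ (L + suc c)       ≡⟨ ρ-cycle (suc c) ⟩
    π (position (suc c)) ≡⟨ cong π position-period ⟩
    π r                 ≡⟨ sym p-end ⟩
    p L                 ≡⟨ sym (ρ-prefix L ≤-refl) ⟩
    ρ L                 ∎
    where open ≡-Reasoning

  -- ρ_0 … ρ_K are distinct: p is simple, avoids the cycle, and one round visits
  -- each position of the cycle once.
  ρ-distinct : Distinct ρ K
  ρ-distinct a b a<b b≤K e = byPosition (a <? L)
    where
      onPath : a < L → Dec (b ≤ L) → ⊥
      onPath a<L (yes b≤L) =
        p-distinct a b a<b b≤L (trans (sym (ρ-prefix a (<⇒≤ a<L))) (trans e (ρ-prefix b b≤L)))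
      onPath a<L (no b≰L)  =
        p-avoids a a<L (position (b ∸ L) , proj₁ (position-range (b ∸ L)) , proj₂ (position-range (b ∸ L)) ,
          sym (trans (sym (ρ-prefix a (<⇒≤ a<L))) (trans e (ρ-beyond b (<⇒≤ (≰⇒> b≰L))))))
      onCycle : L ≤ a → ⊥
      onCycle L≤a =
        <-irrefl (position-injective (≤-trans (∸-monoˡ-≤ L (<⇒≤ a<b)) b∸L≤c) b∸L≤c same-position)
                 (∸-monoˡ-< a<b L≤a)
        where
          L≤b : L ≤ b
          L≤b = ≤-trans L≤a (<⇒≤ a<b)
          b∸L≤c : b ∸ L ≤ c
          b∸L≤c = subst (b ∸ L ≤_) (m+n∸m≡n L c) (∸-monoˡ-≤ L b≤K)
          same-position : position (a ∸ L) ≡ position (b ∸ L)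
          same-position = distinct-injective (FirstCycleAt.distinct D)
            (proj₂ (position-range (a ∸ L))) (proj₂ (position-range (b ∸ L)))
            (trans (sym (ρ-beyond a L≤a)) (trans e (ρ-beyond b L≤b)))
      byPosition : Dec (a < L) → ⊥
      byPosition (yes a<L) = onPath a<L (b ≤? L)
      byPosition (no a≮L)  = onCycle (≮⇒≥ a≮L)

  ρ-firstCycle : FirstCycleAt ρ K L
  ρ-firstCycle = firstCycleAt (m≤m+n L c) ρ-closes ρ-distinct

  rotation : Σ (List U) λ P → Σ (List U) λ Q → cycleWord π j i₀ ≡ P ++ Q × cycleWord ρ K L ≡ Q ++ P
  rotation = applyUpTo (λ t → ℓ (i₀ + t)) e , applyUpTo (λ t → ℓ (r + t)) (suc d) , π-word , ρ-word
    where
      open ≡-Reasoning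
      ℓ : ℕ → U
      ℓ x = lab (π x) (π (suc x))
      π-word : cycleWord π j i₀ ≡ applyUpTo (λ t → ℓ (i₀ + t)) e ++ applyUpTo (λ t → ℓ (r + t)) (suc d)
      π-word = begin
        cycleWord π j i₀
          ≡⟨ cycleWord-walk π j i₀ ⟩
        applyUpTo (λ t → lab (π (i₀ + t)) (π (i₀ + suc t))) (suc j ∸ i₀)
          ≡⟨ cong (applyUpTo _) (+-∸-assoc 1 (FirstCycleAt.i≤j D)) ⟩
        applyUpTo (λ t → lab (π (i₀ + t)) (π (i₀ + suc t))) (suc c)
          ≡⟨ applyUpTo-cong _ _ (suc c) (λ t _ → cong (λ y → lab (π (i₀ + t)) (π y)) (+-suc i₀ t)) ⟩
        applyUpTo (λ t → ℓ (i₀ + t)) (suc c)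
          ≡⟨ segment-split ℓ ⟩
        applyUpTo (λ t → ℓ (i₀ + t)) e ++ applyUpTo (λ t → ℓ (r + t)) (suc d)
          ∎
      ρ-word : cycleWord ρ K L ≡ applyUpTo (λ t → ℓ (r + t)) (suc d) ++ applyUpTo (λ t → ℓ (i₀ + t)) e
      ρ-word = begin
        cycleWord ρ K L
          ≡⟨ cycleWord-walk ρ K L ⟩
        applyUpTo (λ t → lab (ρ (L + t)) (ρ (L + suc t))) (suc K ∸ L)
          ≡⟨ cong (applyUpTo _) (trans (+-∸-assoc 1 (m≤m+n L c)) (cong suc (m+n∸m≡n L c))) ⟩
        applyUpTo (λ t → lab (ρ (L + t)) (ρ (L + suc t))) (suc c)
          ≡⟨ applyUpTo-cong _ _ (suc c) (λ t _ → cong₂ lab (ρ-cycle t)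
               (trans (ρ-cycle (suc t)) (π-next (position t) (proj₂ (position-range t))))) ⟩
        applyUpTo (λ t → ℓ (position t)) (suc c)
          ≡⟨ round-split ℓ ⟩
        applyUpTo (λ t → ℓ (r + t)) (suc d) ++ applyUpTo (λ t → ℓ (i₀ + t)) e
          ∎

-- For every vertex k winning for Player i fix a memoryless strategy T k that
-- wins from k, with move f k.  The region of k consists of the vertices reachable from k
-- when Player i plays f k.  The uniform strategy plays, at w, the move f k w for the least
-- k (in the order of Fin n) whose region contains w.
module Uniformisation (lem : ExcludedMiddle 0ℓ) {U : Set} (Y : List U → Set)
                      (closed : ClosedUnderCyclicPerm Y) (A : Arena U) (i : Player)
                      (pointwise : PointwiseMemoryless A (OFC A Y) i) where
  open Arena A
  open FirstCycles A
  open Strategies A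
  open WinningPlays A (OFC A Y)

  O : (ℕ → V A) → Set
  O = OFC A Y

  Winning : V A → Set
  Winning = WinReg A O i

  chosen : ∀ k → Dec (Winning k) → Strategy A i
  chosen k (yes w) = proj₁ (pointwise k w)
  chosen k (no _)  = defaultStrategy i

  chosen-memoryless : ∀ k d → Memoryless A (chosen k d)
  chosen-memoryless k (yes w) = proj₁ (proj₂ (pointwise k w))
  chosen-memoryless k (no _)  = defaultStrategy-memoryless i

  chosen-wins : ∀ k d → Winning k → WinningFrom A O (chosen k d) k
  chosen-wins k (yes w) _ = proj₂ (proj₂ (pointwise k w))
  chosen-wins k (no ¬w) w = ⊥-elim (¬w w)

  T : V A → Strategy A i
  T k = chosen k lem

  f : V A → V A → V A
  f k = Strategy.move (T k) []

  -- The steps of plays consistent with T k: any edge, the move f k at Player i's vertices.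
  Step : V A → V A → V A → Set
  Step k x y = E x y × (owner x ≡ i → y ≡ f k x)

  module Paths (k : V A) = SimplePaths lem A (Step k)

  Region : V A → V A → Set
  Region k w = Winning k × Paths.Reachable k k w

  Least : V A → V A → Set
  Least w k = Region k w × (∀ k' → toℕ k' < toℕ k → ¬ Region k' w)

  least-unique : ∀ {w k k'} → Least w k → Least w k' → k ≡ k'
  least-unique {k = k} {k'} (reg , min) (reg' , min') with <-cmp (toℕ k) (toℕ k')
  ... | tri< k<k' _ _ = ⊥-elim (min' k k<k' reg)
  ... | tri≈ _ k≡k' _ = toℕ-injective k≡k'
  ... | tri> _ _ k'<k = ⊥-elim (min k' k'<k reg')

  least-exists : ∀ {w k} → Region k w → Σ (V A) (Least w)
  least-exists {w} {k} reg with least lem (λ a → Σ (V A) λ k' → toℕ k' ≡ a × Region k' w) (k , refl , reg)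
  ... | _ , (k' , refl , reg') , below = k' , reg' , λ k'' k''<k' reg'' → below (toℕ k'') k''<k' (k'' , refl , reg'')

  choose : ∀ w → Dec (Σ (V A) (Least w)) → V A
  choose w (yes (k , _)) = f k w
  choose w (no _)        = proj₁ (total w)

  choose-legal : ∀ w d → owner w ≡ i → E w (choose w d)
  choose-legal w (yes (k , _)) o = Strategy.legal (T k) [] w o
  choose-legal w (no _)        _ = proj₂ (total w)

  choose-least : ∀ {w k} → Least w k → ∀ d → choose w d ≡ f k w
  choose-least l (yes (k' , l')) = cong (λ x → f x _) (least-unique l' l)
  choose-least l (no none)       = ⊥-elim (none (_ , l))

  S : Strategy A i
  S = record { move = λ _ w → choose w lem ; legal = λ _ w o → choose-legal w lem o }

  S-memoryless : Memoryless A S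
  S-memoryless _ _ _ _ = refl

  -- Along a play from a winning vertex consistent with S, the least region μ_t of π_t
  -- never increases: π_(t+1) lies in the region of μ_t.
  module Along (v : V A) (winning : Winning v) (π : ℕ → V A) (isPlay : IsPlay A π)
               (start : π 0 ≡ v) (cons : Consistent A S π) where
    open Paths using (_▷_; here)

    region-step : ∀ t {k} → Least (π t) k → Region k (π (suc t))
    region-step t l@((w , reach) , _) =
      w , (reach ▷ (isPlay t , λ o → trans (cons t o) (choose-least l lem)))

    least-at : ∀ t → Σ (V A) (Least (π t))
    least-at zero    = least-exists (winning , subst (Paths.Reachable v v) (sym start) here)
    least-at (suc t) = least-exists (region-step t (proj₂ (least-at t)))

    μ : ℕ → V A
    μ t = proj₁ (least-at t)

    μ-step : ∀ t → toℕ (μ (suc t)) ≤ toℕ (μ t)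
    μ-step t = ≮⇒≥ (λ μt<μ[1+t] → proj₂ (proj₂ (least-at (suc t))) (μ t) μt<μ[1+t] (region-step t (proj₂ (least-at t))))

    μ-antitone : ∀ {t t'} → t ≤ t' → toℕ (μ t') ≤ toℕ (μ t)
    μ-antitone {t} {t'} t≤t' = subst (λ x → toℕ (μ x) ≤ toℕ (μ t)) (m∸n+n≡m t≤t') (iterate (t' ∸ t))
      where
        iterate : ∀ s → toℕ (μ (s + t)) ≤ toℕ (μ t)
        iterate zero    = ≤-refl
        iterate (suc s) = ≤-trans (μ-step (s + t)) (iterate s)

    first : Σ ℕ λ j → Σ ℕ λ i → FirstCycleAt π j i
    first = firstCycleAt-exists lem π
    j i₀ : ℕ
    j  = proj₁ first
    i₀ = proj₁ (proj₂ first)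
    D : FirstCycleAt π j i₀
    D  = proj₂ (proj₂ first)
    m : V A
    m  = μ i₀

    m-region : Region m (π i₀)
    m-region = proj₁ (proj₂ (least-at i₀))

    -- Since π_(j+1) = π_i₀, μ is constant on the cycle, so there π follows f m.
    μ-cycle : ∀ t → i₀ ≤ t → t ≤ suc j → μ t ≡ m
    μ-cycle t i₀≤t t≤1+j =
      toℕ-injective (≤-antisym (μ-antitone i₀≤t) (subst (λ x → toℕ x ≤ toℕ (μ t)) μ-end (μ-antitone t≤1+j)))
      where
        μ-end : μ (suc j) ≡ m
        μ-end = least-unique (subst (λ x → Least x (μ (suc j))) (FirstCycleAt.closes D) (proj₂ (least-at (suc j))))
                             (proj₂ (least-at i₀))

    cycle-steps : ∀ x → i₀ ≤ x → x ≤ j → Step m (π x) (π (suc x))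
    cycle-steps x i₀≤x x≤j = isPlay x , λ o → trans (cons x o) (choose-least least-x lem)
      where
        least-x : Least (π x) m
        least-x = subst (Least (π x)) (μ-cycle x i₀≤x (m≤n⇒m≤1+n x≤j)) (proj₂ (least-at x))

    -- π_i₀ is in the region of m: take a simple path from m following f m that meets
    -- the cycle only at its end π_r.
    module PathsFrom-m = Paths m
    open PathsFrom-m.SimplePath

    entry : Σ (PathsFrom-m.SimplePath m) λ P
          → Visits π i₀ j (end P) × (∀ a → a < len P → ¬ Visits π i₀ j (path P a))
    entry = PathsFrom-m.firstEntry (Visits π i₀ j) (proj₁ simple) (i₀ , ≤-refl , FirstCycleAt.i≤j D , sym (proj₂ simple))
      where
        simple : Σ (PathsFrom-m.SimplePath m) λ P → end P ≡ π i₀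
        simple = PathsFrom-m.simplify (proj₂ m-region)

    P : PathsFrom-m.SimplePath m
    P = proj₁ entry
    hit : Visits π i₀ j (end P)
    hit = proj₁ (proj₂ entry)
    r : ℕ
    r = proj₁ hit

    open Lasso A D r (proj₁ (proj₂ hit)) (proj₁ (proj₂ (proj₂ hit)))
               (len P) (path P) (distinct P) (sym (proj₂ (proj₂ (proj₂ hit)))) (proj₂ (proj₂ entry))

    -- The lasso ρ through this path and the cycle is a play from m consistent with T m,
    -- hence won by Player i; its first-cycle word is a rotation of π's, so π is won too.
    ρ-follows : ∀ t → Step m (ρ t) (ρ (suc t))
    ρ-follows = ρ-steps (Step m) (steps P) cycle-steps

    ρ-won : Won A O i ρ
    ρ-won = chosen-wins m lem (proj₁ m-region) ρ
              (λ t → proj₁ (ρ-follows t)) (trans (ρ-prefix 0 z≤n) (starts P))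
              (λ t o → trans (proj₂ (ρ-follows t) o) (chosen-memoryless m lem [] (prefix A ρ t) (ρ t) o))

    π-won : Won A O i π
    π-won = let (front , back , π-word , ρ-word) = rotation in
      won-respects i (ofc-rotation {Y} closed {P = back} {front} ρ-firstCycle D ρ-word π-word)
                     (ofc-rotation {Y} closed {P = front} {back} D ρ-firstCycle π-word ρ-word) ρ-won

  uniform : UniformMemoryless A O i
  uniform = S , S-memoryless , λ v winning π isPlay start cons → Along.π-won v winning π isPlay start cons

theorem1 : ExcludedMiddle 0ℓ
    → ((U : Set) (Y : List U → Set) (A : Arena U)
         → OnePlayer A → PointwiseMemorylessDetermined A (OFC A Y))
    × (Σ Set λ U → Σ (List U → Set) λ Y → Σ (Arena U) λ A
         → OnePlayer A × ¬ UniformMemorylessDetermined A (OFC A Y))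
    × ((U : Set) (Y : List U → Set) → ClosedUnderCyclicPerm Y → (A : Arena U) (i : Player)
         → PointwiseMemoryless A (OFC A Y) i → UniformMemoryless A (OFC A Y) i)
theorem1 lem =
    (λ U Y A onePlayer → onePlayer-memorylessDetermined lem Y A onePlayer)
  , Counterexample.counterexample
  , (λ U Y closed A i pointwise → Uniformisation.uniform lem Y closed A i pointwise)
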